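{- Let $\mathcal{I}=(P,d,t)$ be a $2$-PR NUkC instance with optimal dilation $1$, and let $\Pi$ be any optimal placement. Let $C_1$ and $C_2$ be two clusters induced by two balls of $\Pi$ with radii $r_i$ and $r_j$ respectively, where $r_i\ge r_j$. Then for every $p\in C_1$ and $q\in C_2$, $d(p,q)>r_i$.
   Context: NUkC with $t$ radii classes: given a finite set $P$ with metric $d$, distinct radii $r_1>\dots>r_t\ge0$ and multiplicities $k_1,\dots,k_t$ summing to $k$, a feasible placement with dilation $\alpha$ consists, for each $i$, of $k_i$ balls $B(p,\alpha r_i)=\{q\in P:d(p,q)\le\alpha r_i\}$ with centers $p\in P$, whose union is $P$; an optimal placement has minimum dilation. A clustering is a partition $\{C_1,\dots,C_k\}$ of $P$ such that some feasible placement has each $C_i$ contained in one of its balls (the clustering is induced by the placement, the cluster $C_i$ by that ball); an optimal clustering is one induced by an optimal placement. A metric $d_1$ is a $\psi$-perturbation of $d$ if $d(p,q)/\psi\le d_1(p,q)\le d(p,q)$ for all $p,q$. The instance is $\psi$-PR if for every metric $\psi$-perturbation $d_1$ of $d$, $(P,d_1,t)$ has a unique optimal clustering and it is identical to the unique optimal clustering of $(P,d,t)$.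
   Formalization: The metric d, the radii and the dilations take rational values, and the metric perturbations in the $2$-PR condition are taken rational as well. -}

module Defs where

open import Data.Nat using (ℕ)
open import Data.Fin using (Fin) renaming (_<_ to _<ᶠ_)
open import Data.Rational using (ℚ; 0ℚ; _≤_; _<_; _*_; _+_)
open import Data.Product using (Σ; ∃; _×_; proj₁)
open import Relation.Binary.PropositionalEquality using (_≡_; _≢_)

Dist : ℕ → Set
Dist n = Fin n → Fin n → ℚ

record IsMetric {n : ℕ} (d : Dist n) : Set where
  field
    refl0 : ∀ p → d p p ≡ 0ℚ
    pos   : ∀ p q → p ≢ q → 0ℚ < d p q
    sym   : ∀ p q → d p q ≡ d q p
    tri   : ∀ p q s → d p s ≤ d p q + d q s

-- radii r_1 > r_2 > ... > r_t ≥ 0 (indices 0..t-1)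
record ValidRadii {t : ℕ} (r : Fin t → ℚ) : Set where
  field
    decr   : ∀ i j → i <ᶠ j → r j < r i
    nonneg : ∀ i → 0ℚ ≤ r i

-- The k = Σ k_i balls: ball (i , j) is the j-th ball of radius class i.
Ball : (t : ℕ) → (Fin t → ℕ) → Set
Ball t k = Σ (Fin t) (λ i → Fin (k i))

Placement : (n t : ℕ) → (Fin t → ℕ) → Set
Placement n t k = Ball t k → Fin n

cls : ∀ {t k} → Ball t k → Fin t
cls = proj₁

InBall : ∀ {n t k} → Dist n → (Fin t → ℚ) → ℚ → Placement n t k → Ball t k → Fin n → Set
InBall d r α Π b q = d (Π b) q ≤ α * r (cls b)

Feasible : ∀ {n t k} → Dist n → (Fin t → ℚ) → ℚ → Placement n t k → Set
Feasible {n} {t} {k} d r α Π = ∀ (q : Fin n) → ∃ λ (b : Ball t k) → InBall d r α Π b q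

OptimalDilation : ∀ {n t} → Dist n → (Fin t → ℚ) → (Fin t → ℕ) → ℚ → Set
OptimalDilation {n} {t} d r k α =
  (∃ λ (Π : Placement n t k) → Feasible d r α Π) ×
  (∀ (β : ℚ) (Π : Placement n t k) → Feasible d r β Π → α ≤ β)

-- A clustering given as an assignment of points to balls; cluster of ball b
-- is {q | σ q ≡ b}.  σ is induced by Π (at dilation α) if each cluster lies in its ball.
Assignment : (n t : ℕ) → (Fin t → ℕ) → Set
Assignment n t k = Fin n → Ball t k

Induces : ∀ {n t k} → Dist n → (Fin t → ℚ) → ℚ → Placement n t k → Assignment n t k → Set
Induces d r α Π σ = ∀ q → InBall d r α Π (σ q) q

OptimalClustering : ∀ {n t} → Dist n → (Fin t → ℚ) → (k : Fin t → ℕ) → Assignment n t k → Set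
OptimalClustering {n} {t} d r k σ =
  ∃ λ (α : ℚ) → ∃ λ (Π : Placement n t k) →
    OptimalDilation d r k α × Feasible d r α Π × Induces d r α Π σ

SamePartition : ∀ {n t k t' k'} → Assignment n t k → Assignment n t' k' → Set
SamePartition {n} σ σ' =
  ∀ (p q : Fin n) → (σ p ≡ σ q → σ' p ≡ σ' q) × (σ' p ≡ σ' q → σ p ≡ σ q)

-- d₁ is a ψ-perturbation of d:  d/ψ ≤ d₁ ≤ d  (first inequality written as d ≤ ψ·d₁, ψ > 0)
IsPerturbation : ∀ {n} → ℚ → Dist n → Dist n → Set
IsPerturbation ψ d d₁ = ∀ p q → (d p q ≤ ψ * d₁ p q) × (d₁ p q ≤ d p q)

-- ψ-perturbation resilience: for every metric ψ-perturbation d₁, (P,d₁,t) has an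
-- optimal clustering, and every optimal clustering of (P,d₁,t) equals every optimal
-- clustering of (P,d,t) (so both are unique and identical).
IsPR : ∀ {n t} → ℚ → Dist n → (Fin t → ℚ) → (Fin t → ℕ) → Set
IsPR {n} {t} ψ d r k =
  ∀ (d₁ : Dist n) → IsMetric d₁ → IsPerturbation ψ d d₁ →
    (∃ λ (σ : Assignment n t k) → OptimalClustering d₁ r k σ) ×
    (∀ (σ σ' : Assignment n t k) → OptimalClustering d₁ r k σ → OptimalClustering d r k σ' →
       SamePartition σ σ')

{-# OPTIONS --safe #-}
-- Suppose p lies in the cluster of a ball B(c, R) (R = α times its radius), q lies in another cluster and
-- d(p,q) ≤ R.  Let d′ be d with an extra edge of length R joining c and q; as d(c,q) ≤ 2R, d′ is a
-- 2-perturbation of d.  If d′ keeps the optimal dilation α, moving q into the ball of c gives an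
-- optimal clustering of d′.  Otherwise some ball of an optimal placement for d′ covers a point only
-- thanks to the new edge, and such a ball contains both p and q.  Either way d′ has an optimal
-- clustering joining p and q, so by resilience σ joins them too.
module Submission where

open import Defs
open import Data.Nat using (ℕ)
open import Data.Fin using (Fin)
open import Data.Rational using (ℚ; 1ℚ; _+_; _≤_; _<_)
open import Data.Product using (proj₁)
open import Relation.Binary.PropositionalEquality using (_≡_; _≢_)

open import Data.Empty using (⊥-elim)
open import Data.Fin using (_≟_)
open import Data.Fin.Properties using (all?; ¬∀⟶∃¬)
open import Data.Product using (∃; _×_; _,_; proj₂)
open import Data.Rational using (0ℚ; _*_; _⊓_)
open import Data.Rational.Properties
  using (≤-trans; ≤-reflexive; ≤-antisym; <⇒≤; ≰⇒>; <-≤-trans; _≤?_;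
         +-mono-≤; +-monoˡ-≤; +-monoʳ-≤; +-identityˡ; +-identityʳ; *-identityˡ;
         ⊓-sel; ⊓-comm; ⊓-glb; p⊓q≤p; p⊓q≤q; p≤q⇒p⊓q≡p; module ≤-Reasoning)
open import Data.Rational.Solver using (module +-*-Solver)
open import Data.Sum using (inj₁; inj₂)
open import Data.Vec.Functional using (updateAt)
open import Data.Vec.Functional.Properties using (updateAt-updates; updateAt-minimal)
open import Function using (const)
open import Relation.Nullary using (¬_; Dec; yes; no)
open import Relation.Binary.PropositionalEquality using (refl; sym; trans; cong; cong₂; subst)

open +-*-Solver using (solve; _:+_; _:*_; _:=_; con)

p≤p+q : ∀ p {q} → 0ℚ ≤ q → p ≤ p + q
p≤p+q p 0≤q = ≤-trans (≤-reflexive (sym (+-identityʳ p))) (+-monoʳ-≤ p 0≤q)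

p≤q+p : ∀ p {q} → 0ℚ ≤ q → p ≤ q + p
p≤q+p p 0≤q = ≤-trans (≤-reflexive (sym (+-identityˡ p))) (+-monoˡ-≤ p 0≤q)

≤-by-slack : ∀ {p q} s → 0ℚ ≤ s → p + s ≡ q → p ≤ q
≤-by-slack {p} s 0≤s refl = p≤p+q p 0≤s

dist-nonneg : ∀ {n} {d : Dist n} → IsMetric d → ∀ x y → 0ℚ ≤ d x y
dist-nonneg metric x y with x ≟ y
... | yes refl = ≤-reflexive (sym (IsMetric.refl0 metric x))
... | no x≢y   = <⇒≤ (IsMetric.pos metric x y x≢y)

-- The shortest-path metric of d with an extra edge of length R joining u and v: a shortest path
-- uses the edge at most once, in one of two directions, so three routes suffice.
module Shortcut {n : ℕ} {d : Dist n} (metric : IsMetric d)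
                (u v : Fin n) {R : ℚ} (0<R : 0ℚ < R) where
  open IsMetric metric using (refl0; pos; tri) renaming (sym to d-sym)
  open ≤-Reasoning

  0≤d : ∀ x y → 0ℚ ≤ d x y
  0≤d = dist-nonneg metric

  via : Fin n → Fin n → Dist n
  via a b x y = d x a + R + d b y

  data Route : Set where
    direct forward backward : Route

  length : Route → Dist n
  length direct   = d
  length forward  = via u v
  length backward = via v u

  shortcut : Dist n
  shortcut x y = d x y ⊓ (via u v x y ⊓ via v u x y)

  shortcut≤length : ∀ ρ x y → shortcut x y ≤ length ρ x y
  shortcut≤length direct   x y = p⊓q≤p _ _
  shortcut≤length forward  x y = ≤-trans (p⊓q≤q (d x y) _) (p⊓q≤p (via u v x y) _)
  shortcut≤length backward x y = ≤-trans (p⊓q≤q (d x y) _) (p⊓q≤q (via u v x y) _)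

  shortcut-attained : ∀ x y → ∃ λ ρ → shortcut x y ≡ length ρ x y
  shortcut-attained x y with ⊓-sel (d x y) (via u v x y ⊓ via v u x y)
  ... | inj₁ e = direct , e
  ... | inj₂ e with ⊓-sel (via u v x y) (via v u x y)
  ...   | inj₁ e′ = forward , trans e e′
  ...   | inj₂ e′ = backward , trans e e′

  shortcut≤d : ∀ x y → shortcut x y ≤ d x y
  shortcut≤d = shortcut≤length direct

  via-pos : ∀ a b x y → 0ℚ < via a b x y
  via-pos a b x y = <-≤-trans 0<R (≤-trans (p≤q+p R (0≤d x a)) (p≤p+q _ (0≤d b y)))

  via-sym : ∀ a b x y → via a b x y ≡ via b a y x
  via-sym a b x y = trans (cong₂ (λ s t → s + R + t) (d-sym x a) (d-sym b y))
    (solve 3 (λ s t R → s :+ R :+ t := t :+ R :+ s) refl (d a x) (d y b) R)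

  d-then-via : ∀ a b x y z → via a b x z ≤ d x y + via a b y z
  d-then-via a b x y z = begin
    d x a + R + d b z               ≤⟨ +-monoˡ-≤ (d b z) (+-monoˡ-≤ R (tri x y a)) ⟩
    d x y + d y a + R + d b z       ≡⟨ solve 4 (λ s t R w → s :+ t :+ R :+ w := s :+ (t :+ R :+ w))
                                               refl (d x y) (d y a) R (d b z) ⟩
    d x y + (d y a + R + d b z)     ∎

  via-then-d : ∀ a b x y z → via a b x z ≤ via a b x y + d y z
  via-then-d a b x y z = begin
    d x a + R + d b z               ≤⟨ +-monoʳ-≤ (d x a + R) (tri b y z) ⟩
    d x a + R + (d b y + d y z)     ≡⟨ solve 4 (λ s R t w → s :+ R :+ (t :+ w) := s :+ R :+ t :+ w)
                                               refl (d x a) R (d b y) (d y z) ⟩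
    d x a + R + d b y + d y z       ∎

  via-then-via : ∀ a b x y z → via a b x z ≤ via a b x y + via a b y z
  via-then-via a b x y z = ≤-by-slack (d b y + d y a + R)
    (≤-trans (<⇒≤ 0<R) (p≤q+p R (+-mono-≤ (0≤d b y) (0≤d y a))))
    (solve 5 (λ s R w t o → s :+ R :+ w :+ (t :+ o :+ R) := s :+ R :+ t :+ (o :+ R :+ w))
      refl (d x a) R (d b z) (d b y) (d y a))

  via-there-and-back : ∀ a b x y z → d x z ≤ via a b x y + via b a y z
  via-there-and-back a b x y z = begin
    d x z                                      ≤⟨ tri x a z ⟩
    d x a + d a z                              ≤⟨ ≤-by-slack (R + d b y + d y b + R) slack≥0
      (solve 5 (λ s w R t o → s :+ w :+ (R :+ t :+ o :+ R) := s :+ R :+ t :+ (o :+ R :+ w))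
        refl (d x a) (d a z) R (d b y) (d y b)) ⟩
    d x a + R + d b y + (d y b + R + d a z)    ∎
    where
    slack≥0 : 0ℚ ≤ R + d b y + d y b + R
    slack≥0 = ≤-trans (<⇒≤ 0<R)
                      (p≤q+p R (+-mono-≤ (+-mono-≤ (<⇒≤ 0<R) (0≤d b y)) (0≤d y b)))

  route-concat : ∀ ρ₁ ρ₂ x y z → ∃ λ ρ → length ρ x z ≤ length ρ₁ x y + length ρ₂ y z
  route-concat direct   direct   x y z = direct   , tri x y z
  route-concat direct   forward  x y z = forward  , d-then-via u v x y z
  route-concat direct   backward x y z = backward , d-then-via v u x y z
  route-concat forward  direct   x y z = forward  , via-then-d u v x y z
  route-concat backward direct   x y z = backward , via-then-d v u x y z
  route-concat forward  forward  x y z = forward  , via-then-via u v x y z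
  route-concat backward backward x y z = backward , via-then-via v u x y z
  route-concat forward  backward x y z = direct   , via-there-and-back u v x y z
  route-concat backward forward  x y z = direct   , via-there-and-back v u x y z

  shortcut-tri : ∀ x y z → shortcut x z ≤ shortcut x y + shortcut y z
  shortcut-tri x y z =
    let (ρ₁ , e₁) = shortcut-attained x y
        (ρ₂ , e₂) = shortcut-attained y z
        (ρ , ρ≤ρ₁ρ₂) = route-concat ρ₁ ρ₂ x y z
    in begin
      shortcut x z                      ≤⟨ shortcut≤length ρ x z ⟩
      length ρ x z                      ≤⟨ ρ≤ρ₁ρ₂ ⟩
      length ρ₁ x y + length ρ₂ y z     ≡⟨ sym (cong₂ _+_ e₁ e₂) ⟩
      shortcut x y + shortcut y z       ∎

  shortcut-sym : ∀ x y → shortcut x y ≡ shortcut y x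
  shortcut-sym x y =
    trans (cong₂ _⊓_ (d-sym x y) (cong₂ _⊓_ (via-sym u v x y) (via-sym v u x y)))
          (cong (d y x ⊓_) (⊓-comm (via v u y x) (via u v y x)))

  length-pos : ∀ ρ {x y} → x ≢ y → 0ℚ < length ρ x y
  length-pos direct   x≢y = pos _ _ x≢y
  length-pos forward  _   = via-pos u v _ _
  length-pos backward _   = via-pos v u _ _

  shortcut-isMetric : IsMetric shortcut
  shortcut-isMetric = record
    { refl0 = λ x → trans (cong (_⊓ (via u v x x ⊓ via v u x x)) (refl0 x))
                          (p≤q⇒p⊓q≡p (⊓-glb (<⇒≤ (via-pos u v x x)) (<⇒≤ (via-pos v u x x))))
    ; pos   = λ x y x≢y → let (ρ , e) = shortcut-attained x y in
                          subst (0ℚ <_) (sym e) (length-pos ρ x≢y)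
    ; sym   = shortcut-sym
    ; tri   = shortcut-tri
    }

  shortcut-edge : shortcut u v ≤ R
  shortcut-edge = begin
    shortcut u v        ≤⟨ shortcut≤length forward u v ⟩
    d u u + R + d v v   ≡⟨ cong₂ (λ s t → s + R + t) (refl0 u) (refl0 v) ⟩
    0ℚ + R + 0ℚ         ≡⟨ trans (+-identityʳ _) (+-identityˡ R) ⟩
    R                   ∎

  d≤via+via : ∀ a b → d a b ≤ R + R → ∀ x y → d x y ≤ via a b x y + via a b x y
  d≤via+via a b dab≤2R x y = begin
    d x y                          ≤⟨ tri x a y ⟩
    d x a + d a y                  ≤⟨ +-monoʳ-≤ (d x a) (tri a b y) ⟩
    d x a + (d a b + d b y)        ≤⟨ +-monoʳ-≤ (d x a) (+-monoˡ-≤ (d b y) dab≤2R) ⟩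
    d x a + (R + R + d b y)        ≤⟨ ≤-by-slack (d x a + d b y) (+-mono-≤ (0≤d x a) (0≤d b y))
      (solve 3 (λ s R t → s :+ (R :+ R :+ t) :+ (s :+ t) := s :+ R :+ t :+ (s :+ R :+ t))
        refl (d x a) R (d b y)) ⟩
    via a b x y + via a b x y      ∎

  shortcut-perturbation : d u v ≤ R + R → IsPerturbation (1ℚ + 1ℚ) d shortcut
  shortcut-perturbation duv≤2R x y =
    ≤-trans d≤2shortcut (≤-reflexive (sym (double (shortcut x y)))) , shortcut≤d x y
    where
    double : ∀ s → (1ℚ + 1ℚ) * s ≡ s + s
    double = solve 1 (λ s → (con 1ℚ :+ con 1ℚ) :* s := s :+ s) refl

    d≤length+length : ∀ ρ → d x y ≤ length ρ x y + length ρ x y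
    d≤length+length direct   = p≤p+q (d x y) (0≤d x y)
    d≤length+length forward  = d≤via+via u v duv≤2R x y
    d≤length+length backward = d≤via+via v u (≤-trans (≤-reflexive (d-sym v u)) duv≤2R) x y

    d≤2shortcut : d x y ≤ shortcut x y + shortcut x y
    d≤2shortcut = let (ρ , e) = shortcut-attained x y in
      subst (λ s → d x y ≤ s + s) (sym e) (d≤length+length ρ)

  via-ball-reaches : ∀ a b {c x y δ} → shortcut c x ≡ via a b c x → shortcut c x ≤ δ →
                     shortcut a y ≤ R → shortcut c y ≤ δ
  via-ball-reaches a b {c} {x} {y} {δ} e cx≤δ ay≤R = begin
    shortcut c y                  ≤⟨ shortcut-tri c a y ⟩
    shortcut c a + shortcut a y   ≤⟨ +-mono-≤ (shortcut≤d c a) ay≤R ⟩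
    d c a + R                     ≤⟨ p≤p+q (d c a + R) (0≤d b x) ⟩
    via a b c x                   ≡⟨ sym e ⟩
    shortcut c x                  ≤⟨ cx≤δ ⟩
    δ                             ∎

  shortcut-ball-reaches : ∀ c x y {δ} → shortcut c x ≤ δ → ¬ d c x ≤ δ →
                          shortcut u y ≤ R → shortcut v y ≤ R → shortcut c y ≤ δ
  shortcut-ball-reaches c x y {δ} cx≤δ cx≰δ uy≤R vy≤R with shortcut-attained c x
  ... | direct   , e = ⊥-elim (cx≰δ (subst (_≤ δ) e cx≤δ))
  ... | forward  , e = via-ball-reaches u v e cx≤δ uy≤R
  ... | backward , e = via-ball-reaches v u e cx≤δ vy≤R

module Clustering {n t : ℕ} (r : Fin t → ℚ) (k : Fin t → ℕ) {α : ℚ} {Π : Placement n t k} where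

  InBall? : ∀ d b y → Dec (InBall d r α Π b y)
  InBall? d b y = d (Π b) y ≤? α * r (cls b)

  Induces⇒Feasible : ∀ {d σ} → Induces d r α Π σ → Feasible d r α Π
  Induces⇒Feasible {σ = σ} induces y = σ y , induces y

  Feasible-mono : ∀ {d d′} → (∀ x y → d′ x y ≤ d x y) → Feasible d r α Π → Feasible d′ r α Π
  Feasible-mono d′≤d feasible y = let (b , y∈b) = feasible y in b , ≤-trans (d′≤d _ y) y∈b

  Induces-mono : ∀ {d d′ σ} → (∀ x y → d′ x y ≤ d x y) →
                 Induces d r α Π σ → Induces d′ r α Π σ
  Induces-mono d′≤d induces y = ≤-trans (d′≤d _ y) (induces y)

  Induces-reassign : ∀ {d σ} y b → InBall d r α Π b y → Induces d r α Π σ →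
                     Induces d r α Π (updateAt σ y (const b))
  Induces-reassign {d} {σ} y b y∈b induces x with x ≟ y
  ... | yes refl = subst (λ b′ → InBall d r α Π b′ x) (sym (updateAt-updates x σ)) y∈b
  ... | no x≢y   =
    subst (λ b′ → InBall d r α Π b′ x) (sym (updateAt-minimal x y σ x≢y)) (induces x)

  optimalClustering-joining : ∀ {d σ} b p q → OptimalDilation d r k α → Feasible d r α Π →
                              Induces d r α Π σ → InBall d r α Π b p → InBall d r α Π b q →
                              ∃ λ τ → OptimalClustering d r k τ × τ p ≡ τ q
  optimalClustering-joining {d} {σ} b p q optimal feasible induces p∈b q∈b =
    τ , (α , Π , optimal , feasible , induces-τ) , trans τp≡b (sym τq≡b)
    where
    σ′ = updateAt σ p (const b)
    τ  = updateAt σ′ q (const b)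
    induces-τ : Induces d r α Π τ
    induces-τ = Induces-reassign {d} q b q∈b (Induces-reassign {d} p b p∈b induces)
    τq≡b : τ q ≡ b
    τq≡b = updateAt-updates q σ′
    τp≡b : τ p ≡ b
    τp≡b with p ≟ q
    ... | yes refl = τq≡b
    ... | no p≢q   = trans (updateAt-minimal p q σ′ p≢q) (updateAt-updates p σ)

module _ {n t : ℕ} {d : Dist n} {r : Fin t → ℚ} {k : Fin t → ℕ} {α : ℚ}
         (metric : IsMetric d) (resilient : IsPR (1ℚ + 1ℚ) d r k)
         (optimal : OptimalDilation d r k α)
         {Π : Placement n t k} (feasible : Feasible d r α Π)
         {σ : Assignment n t k} (induces : Induces d r α Π σ) where

  open Clustering {n} r k

  private
    module Close {p q : Fin n} (p≢q : p ≢ q) (pq≤R : d p q ≤ α * r (cls (σ p))) where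
      open IsMetric metric using (pos; tri) renaming (sym to d-sym)

      R : ℚ
      R = α * r (cls (σ p))

      c : Fin n
      c = Π (σ p)

      0<R : 0ℚ < R
      0<R = <-≤-trans (pos p q p≢q) pq≤R

      open Shortcut metric c q 0<R

      cp≤R : d c p ≤ R
      cp≤R = induces p

      shortcut-cp≤R : shortcut c p ≤ R
      shortcut-cp≤R = ≤-trans (shortcut≤d c p) cp≤R

      shortcut-qp≤R : shortcut q p ≤ R
      shortcut-qp≤R = ≤-trans (shortcut≤d q p) (≤-trans (≤-reflexive (d-sym q p)) pq≤R)

      shortcut-qq≤R : shortcut q q ≤ R
      shortcut-qq≤R = ≤-trans (≤-reflexive (IsMetric.refl0 shortcut-isMetric q)) (<⇒≤ 0<R)

      perturbation : IsPerturbation (1ℚ + 1ℚ) d shortcut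
      perturbation = shortcut-perturbation (≤-trans (tri c p q) (+-mono-≤ cp≤R pq≤R))

      joined-if-dilation-kept : OptimalDilation shortcut r k α →
                                ∃ λ τ → OptimalClustering shortcut r k τ × τ p ≡ τ q
      joined-if-dilation-kept optimal′ =
        optimalClustering-joining {α} {Π} {shortcut} (σ p) p q optimal′
          (Feasible-mono {α} {Π} shortcut≤d feasible)
          (Induces-mono {α} {Π} {σ = σ} shortcut≤d induces)
          shortcut-cp≤R shortcut-edge

      joined-if-shortcut-used : ∀ {α′ Π′ τ} x → OptimalDilation shortcut r k α′ →
                                Feasible shortcut r α′ Π′ → Induces shortcut r α′ Π′ τ →
                                ¬ InBall d r α′ Π′ (τ x) x →
                                ∃ λ τ → OptimalClustering shortcut r k τ × τ p ≡ τ q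
      joined-if-shortcut-used {α′} {Π′} {τ} x optimal′ feasible′ induces′ x∉τx =
        optimalClustering-joining {α′} {Π′} {shortcut} {τ} (τ x) p q optimal′ feasible′ induces′
          (shortcut-ball-reaches (Π′ (τ x)) x p (induces′ x) x∉τx shortcut-cp≤R shortcut-qp≤R)
          (shortcut-ball-reaches (Π′ (τ x)) x q (induces′ x) x∉τx shortcut-edge shortcut-qq≤R)

      joined-from : ∀ {α′ Π′ τ} → OptimalDilation shortcut r k α′ →
                    Feasible shortcut r α′ Π′ → Induces shortcut r α′ Π′ τ →
                    ∃ λ τ → OptimalClustering shortcut r k τ × τ p ≡ τ q
      joined-from {α′} {Π′} {τ} optimal′ feasible′ induces′
        with all? (λ y → InBall? {α′} {Π′} d (τ y) y)
      ... | yes τ-in-d =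
        joined-if-dilation-kept (subst (OptimalDilation shortcut r k) α′≡α optimal′)
        where
        α′≡α : α′ ≡ α
        α′≡α = ≤-antisym (proj₂ optimal′ α Π (Feasible-mono {α} {Π} shortcut≤d feasible))
                         (proj₂ optimal α′ Π′ (Induces⇒Feasible {α′} {Π′} {d} {τ} τ-in-d))
      ... | no τ-not-in-d =
        let (x , x∉τx) = ¬∀⟶∃¬ n _ (λ y → InBall? {α′} {Π′} d (τ y) y) τ-not-in-d
        in joined-if-shortcut-used x optimal′ feasible′ induces′ x∉τx

      joined : ∃ λ τ → OptimalClustering shortcut r k τ × τ p ≡ τ q
      joined = let (_ , _ , _ , optimal′ , feasible′ , induces′) =
                     proj₁ (resilient shortcut shortcut-isMetric perturbation)
               in joined-from optimal′ feasible′ induces′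

      σp≡σq : σ p ≡ σ q
      σp≡σq = let (τ , optimalτ , τp≡τq) = joined in
        proj₁ (proj₂ (resilient shortcut shortcut-isMetric perturbation) τ σ optimalτ
                 (α , Π , optimal , feasible , induces) p q) τp≡τq

  close⇒same-cluster : ∀ p q → d p q ≤ α * r (cls (σ p)) → σ p ≡ σ q
  close⇒same-cluster p q pq≤R with p ≟ q
  ... | yes refl = refl
  ... | no p≢q   = Close.σp≡σq p≢q pq≤R

lemma8 : (n t : ℕ) (d : Dist n) (r : Fin t → ℚ) (k : Fin t → ℕ) →
    IsMetric d → ValidRadii r → IsPR (1ℚ + 1ℚ) d r k →
    OptimalDilation d r k 1ℚ →
    (Π : Placement n t k) → Feasible d r 1ℚ Π →
    (σ : Assignment n t k) → Induces d r 1ℚ Π σ →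
    (b₁ b₂ : Ball t k) → b₁ ≢ b₂ → r (cls b₂) ≤ r (cls b₁) →
    (p q : Fin n) → σ p ≡ b₁ → σ q ≡ b₂ → r (cls b₁) < d p q
lemma8 n t d r k metric _ resilient optimal Π feasible σ induces b₁ b₂ b₁≢b₂ _ p q σp≡b₁ σq≡b₂ =
  ≰⇒> λ pq≤r₁ → b₁≢b₂ (trans (sym σp≡b₁) (trans (σp≡σq pq≤r₁) σq≡b₂))
  where
  σp≡σq : d p q ≤ r (cls b₁) → σ p ≡ σ q
  σp≡σq pq≤r₁ = close⇒same-cluster metric resilient optimal feasible induces p q
    (subst (λ b → d p q ≤ 1ℚ * r (cls b)) (sym σp≡b₁)
           (≤-trans pq≤r₁ (≤-reflexive (sym (*-identityˡ _)))))
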